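{- Definitions of closedness. A class $\mathcal K$ (of $\lambda$-ho-term-graphs or of $\lambda$-ap-ho-term-graphs over $\Sigma^\lambda_i$) is closed under functional bisimulations on the underlying term graphs if the following holds: for every $\mathcal G\in\mathcal K$ and every homomorphism $h$ from the term graph underlying $\mathcal G$ to a term graph $G'$, there is $\mathcal G'\in\mathcal K$ with underlying term graph $G'$ such that $h$ is a homomorphism from $\mathcal G$ to $\mathcal G'$. It is closed under converse functional bisimulations on the underlying term graphs if the following holds: for every $\mathcal G\in\mathcal K$ and every homomorphism $h$ from a term graph $G'$ to the term graph underlying $\mathcal G$, there is $\mathcal G'\in\mathcal K$ with underlying term graph $G'$ such that $h$ is a homomorphism from $\mathcal G'$ to $\mathcal G$. Statement. (i) Neither the class of $\lambda$-ho-term-graphs over $\Sigma^\lambda_0$ nor the class of $\lambda$-ap-ho-term-graphs over $\Sigma^\lambda_0$ is closed under functional bisimulations on the underlying term graphs. Neither is closed under converse functional bisimulations on the underlying term graphs. (ii) Neither the class of $\lambda$-ho-term-graphs over $\Sigma^\lambda_1$ nor the class of $\lambda$-ap-ho-term-graphs over $\Sigma^\lambda_1$ is closed under converse functional bisimulations on the underlying term graphs.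
   Context: Term graphs. A term graph over a signature $\Sigma$ is a tuple $(V,\mathit{lab},\mathit{args},r)$, where: - $\mathit{args}(v)\in V^*$ has length equal to the arity of $\mathit{lab}(v)$; - every vertex is reachable from the root $r$. Write $w\rightarrowtail_kw'$ if $w'$ is the $k$-th entry (from $0$) of $\mathit{args}(w)$. Homomorphisms. A term-graph homomorphism $h$ satisfies $h(r_1)=r_2$, preserves labels, and has $\mathit{args}_2(h(v))=\bar h(\mathit{args}_1(v))$. Notation. $\Sigma^\lambda_i=\{@,\lambda,0\}$ with arities $2,1,i$ ($i\in\{0,1\}$), and $V(\lambda)$ denotes the $\lambda$-labelled vertices. For words: $\epsilon$ is empty, juxtaposition is concatenation, $\le$ is the prefix order. $\lambda$-ho-term-graphs. A $\lambda$-ho-term-graph over $\Sigma^\lambda_i$ is $(V,\mathit{lab},\mathit{args},r,\mathit{Sc})$, with $(V,\mathit{lab},\mathit{args},r)$ (its underlying term graph) a term graph over $\Sigma^\lambda_i$ and $\mathit{Sc}:V(\lambda)\to\mathcal P(V)$. Writing $\mathit{Sc}^-(v)=\mathit{Sc}(v)\setminus\{v\}$: - $r\notin\mathit{Sc}^-(v)$; - $v\in\mathit{Sc}(v)$; - $v_1\in\mathit{Sc}^-(v_0)$ implies $\mathit{Sc}(v_1)\subseteq\mathit{Sc}^-(v_0)$; - $w\rightarrowtail_kw_k$ and $w_k\in\mathit{Sc}^-(v)$ imply $w\in\mathit{Sc}(v)$; - every $0$-labelled $w$ lies in some $\mathit{Sc}^-(v_0)$; - if $i=1$: $0$-labelled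 $w\rightarrowtail_0 w_0$ implies $w_0\in V(\lambda)$ and, for all $v\in V(\lambda)$, ($w\in\mathit{Sc}(v)\iff w_0\in\mathit{Sc}(v)$). A homomorphism of such graphs is a term-graph homomorphism with $\{h(u):u\in\mathit{Sc}_1(v)\}=\mathit{Sc}_2(h(v))$. $\lambda$-ap-ho-term-graphs. A $\lambda$-ap-ho-term-graph over $\Sigma^\lambda_i$ is $(V,\mathit{lab},\mathit{args},r,P)$ with $P:V\to V^*$ such that: - $P(r)=\epsilon$; - $\lambda$-vertex $w\rightarrowtail_0w_0$ implies $P(w_0)\le P(w)w$; - $@$-vertex $w\rightarrowtail_kw_k$ implies $P(w_k)\le P(w)$; - $0$-vertex $w$ implies $P(w)\ne\epsilon$; - if $i=1$: $0$-vertex $w\rightarrowtail_0w_0$ implies $\mathit{lab}(w_0)=\lambda$ and $P(w_0)w_0=P(w)$. Homomorphisms are term-graph homomorphisms with $P_2(h(w))=\bar h(P_1(w))$. -}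

module Defs where

open import Data.Nat using (ℕ; zero; suc)
open import Data.Fin using (Fin; toℕ)
open import Data.List using (List; []; _∷_; _++_; length; map; lookup)
open import Data.List.Membership.Propositional using (_∈_)
open import Data.Product using (Σ; ∃; _×_; _,_)
open import Relation.Binary.PropositionalEquality using (_≡_; _≢_)
open import Relation.Nullary using (¬_)
open import Level using () renaming (suc to lsuc; zero to lzero)

data Lab : Set where
  app lam var : Lab

arity : ℕ → Lab → ℕ
arity i app = 2
arity i lam = 1
arity i var = i

data Reach {n : ℕ} (args : Fin n → List (Fin n)) (r : Fin n) : Fin n → Set where
  here : Reach args r r
  step : ∀ {w w'} → Reach args r w → w' ∈ args w → Reach args r w'

module _ (i : ℕ) where

  record TermGraph : Set where
    field
      n      : ℕ
      lab    : Fin n → Lab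
      args   : Fin n → List (Fin n)
      args-length : ∀ v → length (args v) ≡ arity i (lab v)
      root   : Fin n
      reachable : ∀ v → Reach args root v

open TermGraph public

module _ {i : ℕ} (G : TermGraph i) where

  V : Set
  V = Fin (n G)

  -- w ↣_k w' : w' is the k-th entry (from 0) of args(w)
  Edge : V → ℕ → V → Set
  Edge w k w' = Σ (Fin (length (args G w))) λ k' → (toℕ k' ≡ k) × (lookup (args G w) k' ≡ w')

  IsLam : V → Set
  IsLam v = lab G v ≡ lam

record IsTGHom {i : ℕ} (G₁ G₂ : TermGraph i) (h : V G₁ → V G₂) : Set where
  field
    hom-root : h (root G₁) ≡ root G₂
    hom-lab  : ∀ v → lab G₂ (h v) ≡ lab G₁ v
    hom-args : ∀ v → args G₂ (h v) ≡ map h (args G₁ v)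

-- λ-ho-term-graphs: a term graph together with a scope function.
-- Sc is given as a predicate on all vertices, but only its values on
-- λ-vertices are ever used (Sc : V(λ) → P(V)).

module _ {i : ℕ} (G : TermGraph i) where

  ScopeFun : Set₁
  ScopeFun = V G → V G → Set   -- Sc v w  means  w ∈ Sc(v)

  Sc⁻ : ScopeFun → V G → V G → Set
  Sc⁻ Sc v w = Sc v w × w ≢ v

  record IsHoScope (Sc : ScopeFun) : Set where
    field
      sc-root  : ∀ v → IsLam G v → ¬ Sc⁻ Sc v (root G)
      sc-self  : ∀ v → IsLam G v → Sc v v
      sc-nest  : ∀ v₀ v₁ → IsLam G v₀ → IsLam G v₁ → Sc⁻ Sc v₀ v₁ →
                 ∀ u → Sc v₁ u → Sc⁻ Sc v₀ u
      sc-close : ∀ v w k wₖ → IsLam G v → Edge G w k wₖ → Sc⁻ Sc v wₖ → Sc v w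
      sc-var   : ∀ w → lab G w ≡ var → Σ (V G) λ v₀ → IsLam G v₀ × Sc⁻ Sc v₀ w
      sc-back  : i ≡ 1 → ∀ w w₀ → lab G w ≡ var → Edge G w 0 w₀ →
                 IsLam G w₀ × (∀ v → IsLam G v → (Sc v w → Sc v w₀) × (Sc v w₀ → Sc v w))

  record HoStruct : Set₁ where
    field
      Sc      : ScopeFun
      isScope : IsHoScope Sc

open HoStruct public

IsHoHom : {i : ℕ} {G₁ G₂ : TermGraph i} → HoStruct G₁ → HoStruct G₂ →
          (V G₁ → V G₂) → Set
IsHoHom {G₁ = G₁} {G₂} S₁ S₂ h =
  IsTGHom G₁ G₂ h ×
  (∀ v → IsLam G₁ v → ∀ w →
     (Sc S₂ (h v) w → Σ (V G₁) λ u → Sc S₁ v u × h u ≡ w) ×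
     ((Σ (V G₁) λ u → Sc S₁ v u × h u ≡ w) → Sc S₂ (h v) w))

_≤ₚ_ : {A : Set} → List A → List A → Set
xs ≤ₚ ys = ∃ λ zs → xs ++ zs ≡ ys

module _ {i : ℕ} (G : TermGraph i) where

  record IsAP (P : V G → List (V G)) : Set where
    field
      ap-root : P (root G) ≡ []
      ap-lam  : ∀ w w₀ → lab G w ≡ lam → Edge G w 0 w₀ → P w₀ ≤ₚ (P w ++ (w ∷ []))
      ap-app  : ∀ w k wₖ → lab G w ≡ app → Edge G w k wₖ → P wₖ ≤ₚ P w
      ap-var  : ∀ w → lab G w ≡ var → P w ≢ []
      ap-back : i ≡ 1 → ∀ w w₀ → lab G w ≡ var → Edge G w 0 w₀ →
                lab G w₀ ≡ lam × (P w₀ ++ (w₀ ∷ []) ≡ P w)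

  record APStruct : Set where
    field
      P    : V G → List (V G)
      isAP : IsAP P

open APStruct public

IsAPHom : {i : ℕ} {G₁ G₂ : TermGraph i} → APStruct G₁ → APStruct G₂ →
          (V G₁ → V G₂) → Set
IsAPHom {G₁ = G₁} {G₂} S₁ S₂ h =
  IsTGHom G₁ G₂ h × (∀ w → P S₂ (h w) ≡ map h (P S₁ w))

-- Closedness of a class K (given by extra structure S on term graphs and
-- a notion of homomorphism Hom between structured graphs).

module _ {i : ℕ} {ℓ ℓ' : Level.Level}
         (S : TermGraph i → Set ℓ)
         (Hom : {G₁ G₂ : TermGraph i} → S G₁ → S G₂ → (V G₁ → V G₂) → Set ℓ') where

  ClosedUnderFB : Set (ℓ Level.⊔ ℓ')
  ClosedUnderFB =
    ∀ (G : TermGraph i) (s : S G) (G' : TermGraph i) (h : V G → V G') →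
    IsTGHom G G' h → Σ (S G') λ s' → Hom s s' h

  ClosedUnderConverseFB : Set (ℓ Level.⊔ ℓ')
  ClosedUnderConverseFB =
    ∀ (G : TermGraph i) (s : S G) (G' : TermGraph i) (h : V G' → V G) →
    IsTGHom G' G h → Σ (S G') λ s' → Hom s' s h

-- A binder dominates its scope: Sc⁻(v) is closed under predecessors other
-- than v, so a path from the root into Sc⁻(v) avoiding v would put the root
-- into Sc⁻(v).  Vertices identified by an ap-homomorphism have prefixes of
-- equal length, and the body of a top-level binder w, if its prefix is
-- non-empty, has prefix exactly w.  Merging the variable occurrences of
-- λx. x (λy. y) puts x into the scope of λy although x is reachable avoiding
-- λy, and identifies vertices with prefixes of lengths 1 and 2.  Unsharing
-- the abstraction of (λx. x)(λx. x) while keeping its body shared leaves one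
-- variable below two distinct top-level binders, with or without back-links.
module Submission where

open import Defs
open import Data.Nat using (ℕ)
open import Data.Fin using (Fin; zero; suc)
open import Data.List using (List; []; _∷_; _++_; map; length)
open import Data.List.Properties using (length-map; ∷-injectiveˡ)
open import Data.List.Relation.Unary.Any using (here; there)
open import Data.Product using (∃; _×_; _,_; proj₁; proj₂)
open import Data.Unit using (⊤; tt)
open import Data.Empty using (⊥; ⊥-elim)
open import Relation.Nullary using (¬_)
open import Relation.Binary.PropositionalEquality
  using (_≡_; _≢_; refl; sym; trans; cong; subst; module ≡-Reasoning)

pattern f0 = zero
pattern f1 = suc zero
pattern f2 = suc (suc zero)
pattern f3 = suc (suc (suc zero))
pattern f4 = suc (suc (suc (suc zero)))

module _ {i : ℕ} {G₁ G₂ : TermGraph i} {h : V G₁ → V G₂} where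

  hoHom-scope-image : (S₁ : HoStruct G₁) (S₂ : HoStruct G₂) → IsHoHom S₁ S₂ h →
                      ∀ {v u} → IsLam G₁ v → Sc S₁ v u → Sc S₂ (h v) (h u)
  hoHom-scope-image _ _ (_ , sc) {v} {u} lv s = proj₂ (sc v lv (h u)) (u , s , refl)

  hoHom-scope-preimage : (S₁ : HoStruct G₁) (S₂ : HoStruct G₂) → IsHoHom S₁ S₂ h →
                         ∀ {v w} → IsLam G₁ v → Sc S₂ (h v) w → ∃ λ u → Sc S₁ v u × h u ≡ w
  hoHom-scope-preimage _ _ (_ , sc) {v} {w} lv = proj₁ (sc v lv w)

  apHom-prefix-length : (S₁ : APStruct G₁) (S₂ : APStruct G₂) → IsAPHom S₁ S₂ h →
                        ∀ {w w'} → h w ≡ h w' → length (P S₁ w) ≡ length (P S₁ w')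
  apHom-prefix-length S₁ S₂ (_ , pre) {w} {w'} hw≡hw' = begin
    length (P S₁ w)            ≡⟨ sym (length-map h (P S₁ w)) ⟩
    length (map h (P S₁ w))    ≡⟨ cong length (sym (pre w)) ⟩
    length (P S₂ (h w))        ≡⟨ cong (λ x → length (P S₂ x)) hw≡hw' ⟩
    length (P S₂ (h w'))       ≡⟨ cong length (pre w') ⟩
    length (map h (P S₁ w'))   ≡⟨ length-map h (P S₁ w') ⟩
    length (P S₁ w')           ∎
    where open ≡-Reasoning

  apHom-empty-prefix : (S₁ : APStruct G₁) (S₂ : APStruct G₂) → IsAPHom S₁ S₂ h →
                       ∀ {w} → P S₂ (h w) ≡ [] → P S₁ w ≡ []
  apHom-empty-prefix S₁ _ (_ , pre) {w} empty = map≡[]⇒≡[] (P S₁ w) (trans (sym (pre w)) empty)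
    where
    map≡[]⇒≡[] : ∀ xs → map h xs ≡ [] → xs ≡ []
    map≡[]⇒≡[] [] _ = refl

-- Only the vertices before the endpoint are required to differ from v.
data PathAvoiding {i : ℕ} (G : TermGraph i) (v : V G) : V G → V G → Set where
  []   : ∀ {u} → PathAvoiding G v u u
  step : ∀ {w k w' u} → w ≢ v → Edge G w k w' → PathAvoiding G v w' u → PathAvoiding G v w u

module _ {i : ℕ} {G : TermGraph i} {Sc : ScopeFun G} (scope : IsHoScope G Sc) where

  open IsHoScope scope

  scope⁻-backward : ∀ {v w u} → IsLam G v → PathAvoiding G v w u → Sc⁻ G Sc v u → Sc⁻ G Sc v w
  scope⁻-backward lv []                s = s
  scope⁻-backward lv (step w≢v e path) s = sc-close _ _ _ _ lv e (scope⁻-backward lv path s) , w≢v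

  binder-dominates-scope : ∀ {v u} → IsLam G v → Sc⁻ G Sc v u → ¬ PathAvoiding G v (root G) u
  binder-dominates-scope lv s path = sc-root _ lv (scope⁻-backward lv path s)

nonempty-prefix-of-singleton : {A : Set} {y : A} (xs : List A) → xs ≢ [] → xs ≤ₚ (y ∷ []) → xs ≡ y ∷ []
nonempty-prefix-of-singleton []            xs≢[] _            = ⊥-elim (xs≢[] refl)
nonempty-prefix-of-singleton (x ∷ [])      _     (.[] , refl) = refl
nonempty-prefix-of-singleton (x ∷ x' ∷ xs) _     (_ , ())

module _ {i : ℕ} {G : TermGraph i} {P : V G → List (V G)} (ap : IsAP G P) where

  open IsAP ap

  body-prefix-of-top-binder : ∀ {w w₀} → lab G w ≡ lam → Edge G w 0 w₀ →
                              P w ≡ [] → P w₀ ≢ [] → P w₀ ≡ w ∷ []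
  body-prefix-of-top-binder {w} {w₀} lw e top nonempty =
    nonempty-prefix-of-singleton (P w₀) nonempty
      (subst (λ p → P w₀ ≤ₚ (p ++ w ∷ [])) top (ap-lam w w₀ lw e))

  top-binders-of-shared-body : ∀ {w w' w₀} → lab G w ≡ lam → lab G w' ≡ lam →
                               Edge G w 0 w₀ → Edge G w' 0 w₀ → P w ≡ [] → P w' ≡ [] →
                               P w₀ ≢ [] → w ≡ w'
  top-binders-of-shared-body lw lw' e e' top top' nonempty = ∷-injectiveˡ (trans
    (sym (body-prefix-of-top-binder lw e top nonempty))
    (body-prefix-of-top-binder lw' e' top' nonempty))

-- λx. x (λy. y)
distinctVars : TermGraph 0
distinctVars = record
  { n = 5 ; lab = lab′ ; args = args′ ; args-length = args-length′ ; root = f0 ; reachable = reachable′ }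
  where
  lab′ : Fin 5 → Lab
  lab′ = λ { f0 → lam ; f1 → app ; f2 → var ; f3 → lam ; f4 → var }
  args′ : Fin 5 → List (Fin 5)
  args′ = λ { f0 → f1 ∷ [] ; f1 → f2 ∷ f3 ∷ [] ; f2 → [] ; f3 → f4 ∷ [] ; f4 → [] }
  args-length′ : ∀ v → length (args′ v) ≡ arity 0 (lab′ v)
  args-length′ = λ { f0 → refl ; f1 → refl ; f2 → refl ; f3 → refl ; f4 → refl }
  reachable′ : ∀ v → Reach args′ f0 v
  reachable′ f0 = here
  reachable′ f1 = step here (here refl)
  reachable′ f2 = step (step here (here refl)) (here refl)
  reachable′ f3 = step (step here (here refl)) (there (here refl))
  reachable′ f4 = step (step (step here (here refl)) (there (here refl))) (here refl)

-- λx. x (λy. y) with the occurrences of x and y as one vertex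
mergedVars : TermGraph 0
mergedVars = record
  { n = 4 ; lab = lab′ ; args = args′ ; args-length = args-length′ ; root = f0 ; reachable = reachable′ }
  where
  lab′ : Fin 4 → Lab
  lab′ = λ { f0 → lam ; f1 → app ; f2 → var ; f3 → lam }
  args′ : Fin 4 → List (Fin 4)
  args′ = λ { f0 → f1 ∷ [] ; f1 → f2 ∷ f3 ∷ [] ; f2 → [] ; f3 → f2 ∷ [] }
  args-length′ : ∀ v → length (args′ v) ≡ arity 0 (lab′ v)
  args-length′ = λ { f0 → refl ; f1 → refl ; f2 → refl ; f3 → refl }
  reachable′ : ∀ v → Reach args′ f0 v
  reachable′ f0 = here
  reachable′ f1 = step here (here refl)
  reachable′ f2 = step (step here (here refl)) (here refl)
  reachable′ f3 = step (step here (here refl)) (there (here refl))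

mergeVars : Fin 5 → Fin 4
mergeVars = λ { f0 → f0 ; f1 → f1 ; f2 → f2 ; f3 → f3 ; f4 → f2 }

mergeVars-hom : IsTGHom distinctVars mergedVars mergeVars
mergeVars-hom = record
  { hom-root = refl
  ; hom-lab  = λ { f0 → refl ; f1 → refl ; f2 → refl ; f3 → refl ; f4 → refl }
  ; hom-args = λ { f0 → refl ; f1 → refl ; f2 → refl ; f3 → refl ; f4 → refl }
  }

distinctVars-ho : HoStruct distinctVars
distinctVars-ho = record { Sc = Sc′ ; isScope = record
  { sc-root = sc-root′ ; sc-self = sc-self′ ; sc-nest = sc-nest′ ; sc-close = sc-close′
  ; sc-var = sc-var′ ; sc-back = λ () } }
  where
  Sc′ : Fin 5 → Fin 5 → Set
  Sc′ f0 _  = ⊤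
  Sc′ f3 f3 = ⊤
  Sc′ f3 f4 = ⊤
  Sc′ _  _  = ⊥
  sc-root′ : ∀ v → IsLam distinctVars v → ¬ Sc⁻ distinctVars Sc′ v f0
  sc-root′ f0 _ (_ , ne) = ne refl
  sc-root′ f3 _ (() , _)
  sc-self′ : ∀ v → IsLam distinctVars v → Sc′ v v
  sc-self′ f0 _ = tt
  sc-self′ f3 _ = tt
  sc-self′ f1 ()
  sc-self′ f2 ()
  sc-self′ f4 ()
  sc-nest′ : ∀ v₀ v₁ → IsLam distinctVars v₀ → IsLam distinctVars v₁ → Sc⁻ distinctVars Sc′ v₀ v₁ →
             ∀ u → Sc′ v₁ u → Sc⁻ distinctVars Sc′ v₀ u
  sc-nest′ f0 f0 _ _ (_ , ne) _  _ = ⊥-elim (ne refl)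
  sc-nest′ f0 f3 _ _ _        f3 _ = tt , λ ()
  sc-nest′ f0 f3 _ _ _        f4 _ = tt , λ ()
  sc-nest′ f3 f3 _ _ (_ , ne) _  _ = ⊥-elim (ne refl)
  sc-close′ : ∀ v w k wₖ → IsLam distinctVars v → Edge distinctVars w k wₖ →
              Sc⁻ distinctVars Sc′ v wₖ → Sc′ v w
  sc-close′ f0 _  _ _ _ _                       _        = tt
  sc-close′ f3 f0 _ _ _ (zero , _ , refl)     (() , _)
  sc-close′ f3 f1 _ _ _ (zero , _ , refl)     (() , _)
  sc-close′ f3 f1 _ _ _ (suc zero , _ , refl) (_ , ne) = ⊥-elim (ne refl)
  sc-close′ f3 f2 _ _ _ (() , _)
  sc-close′ f3 f3 _ _ _ (zero , _ , refl)     _        = tt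
  sc-close′ f3 f4 _ _ _ (() , _)
  sc-var′ : ∀ w → lab distinctVars w ≡ var → ∃ λ v₀ → IsLam distinctVars v₀ × Sc⁻ distinctVars Sc′ v₀ w
  sc-var′ f2 _ = f0 , refl , tt , λ ()
  sc-var′ f4 _ = f0 , refl , tt , λ ()

distinctVars-ap : APStruct distinctVars
distinctVars-ap = record { P = P′ ; isAP = record
  { ap-root = refl ; ap-lam = ap-lam′ ; ap-app = ap-app′ ; ap-var = ap-var′ ; ap-back = λ () } }
  where
  P′ : Fin 5 → List (Fin 5)
  P′ = λ { f0 → [] ; f1 → f0 ∷ [] ; f2 → f0 ∷ [] ; f3 → f0 ∷ [] ; f4 → f0 ∷ f3 ∷ [] }
  ap-lam′ : ∀ w w₀ → lab distinctVars w ≡ lam → Edge distinctVars w 0 w₀ → P′ w₀ ≤ₚ (P′ w ++ w ∷ [])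
  ap-lam′ f0 _ _ (zero , _ , refl) = [] , refl
  ap-lam′ f3 _ _ (zero , _ , refl) = [] , refl
  ap-lam′ f1 _ () _
  ap-lam′ f2 _ () _
  ap-lam′ f4 _ () _
  ap-app′ : ∀ w k wₖ → lab distinctVars w ≡ app → Edge distinctVars w k wₖ → P′ wₖ ≤ₚ P′ w
  ap-app′ f1 _ _ _ (zero , _ , refl)     = [] , refl
  ap-app′ f1 _ _ _ (suc zero , _ , refl) = [] , refl
  ap-app′ f0 _ _ () _
  ap-app′ f2 _ _ () _
  ap-app′ f3 _ _ () _
  ap-app′ f4 _ _ () _
  ap-var′ : ∀ w → lab distinctVars w ≡ var → P′ w ≢ []
  ap-var′ f2 _ ()
  ap-var′ f4 _ ()

not-closed-FB-ho : ¬ ClosedUnderFB {0} HoStruct IsHoHom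
not-closed-FB-ho closed with closed distinctVars distinctVars-ho mergedVars mergeVars mergeVars-hom
... | S , hom = binder-dominates-scope (isScope S) refl (x-in-scope-of-λy , λ ()) root⇝x
  where
  x-in-scope-of-λy : Sc S f3 f2
  x-in-scope-of-λy = hoHom-scope-image distinctVars-ho S hom {f3} {f4} refl tt
  root⇝x : PathAvoiding mergedVars f3 f0 f2
  root⇝x = step (λ ()) (zero , refl , refl) (step (λ ()) (zero , refl , refl) [])

not-closed-FB-ap : ¬ ClosedUnderFB {0} APStruct IsAPHom
not-closed-FB-ap closed with closed distinctVars distinctVars-ap mergedVars mergeVars mergeVars-hom
... | S , hom with apHom-prefix-length distinctVars-ap S hom {f2} {f4} refl
...   | ()

-- A variable vertex of Σ^λ_0 has no argument; one of Σ^λ_1 points back to its binder.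
data VarArity : ℕ → Set where
  nullary    : VarArity 0
  backLinked : VarArity 1

varArgs : ∀ {i n} → VarArity i → Fin n → List (Fin n)
varArgs nullary    _      = []
varArgs backLinked binder = binder ∷ []

varArgs-length : ∀ {i n} (a : VarArity i) (binder : Fin n) → length (varArgs a binder) ≡ i
varArgs-length nullary    _ = refl
varArgs-length backLinked _ = refl

map-varArgs : ∀ {i m n} (a : VarArity i) (h : Fin m → Fin n) (binder : Fin m) →
              map h (varArgs a binder) ≡ varArgs a (h binder)
map-varArgs nullary    _ _ = refl
map-varArgs backLinked _ _ = refl

-- (λx. x)(λx. x) with both operands one vertex
sharedAbs : ∀ {i} → VarArity i → TermGraph i
sharedAbs {i} a = record
  { n = 3 ; lab = lab′ ; args = args′ ; args-length = args-length′ ; root = f0 ; reachable = reachable′ }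
  where
  lab′ : Fin 3 → Lab
  lab′ = λ { f0 → app ; f1 → lam ; f2 → var }
  args′ : Fin 3 → List (Fin 3)
  args′ = λ { f0 → f1 ∷ f1 ∷ [] ; f1 → f2 ∷ [] ; f2 → varArgs a f1 }
  args-length′ : ∀ v → length (args′ v) ≡ arity i (lab′ v)
  args-length′ = λ { f0 → refl ; f1 → refl ; f2 → varArgs-length a f1 }
  reachable′ : ∀ v → Reach args′ f0 v
  reachable′ f0 = here
  reachable′ f1 = step here (here refl)
  reachable′ f2 = step (step here (here refl)) (here refl)

-- (λx. x)(λx. x) with distinct abstractions sharing their body
sharedBody : ∀ {i} → VarArity i → TermGraph i
sharedBody {i} a = record
  { n = 4 ; lab = lab′ ; args = args′ ; args-length = args-length′ ; root = f0 ; reachable = reachable′ }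
  where
  lab′ : Fin 4 → Lab
  lab′ = λ { f0 → app ; f1 → lam ; f2 → lam ; f3 → var }
  args′ : Fin 4 → List (Fin 4)
  args′ = λ { f0 → f1 ∷ f2 ∷ [] ; f1 → f3 ∷ [] ; f2 → f3 ∷ [] ; f3 → varArgs a f1 }
  args-length′ : ∀ v → length (args′ v) ≡ arity i (lab′ v)
  args-length′ = λ { f0 → refl ; f1 → refl ; f2 → refl ; f3 → varArgs-length a f1 }
  reachable′ : ∀ v → Reach args′ f0 v
  reachable′ f0 = here
  reachable′ f1 = step here (here refl)
  reachable′ f2 = step here (there (here refl))
  reachable′ f3 = step (step here (here refl)) (here refl)

shareAbs : Fin 4 → Fin 3
shareAbs = λ { f0 → f0 ; f1 → f1 ; f2 → f1 ; f3 → f2 }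

shareAbs-hom : ∀ {i} (a : VarArity i) → IsTGHom (sharedBody a) (sharedAbs a) shareAbs
shareAbs-hom a = record
  { hom-root = refl
  ; hom-lab  = λ { f0 → refl ; f1 → refl ; f2 → refl ; f3 → refl }
  ; hom-args = λ { f0 → refl ; f1 → refl ; f2 → refl ; f3 → sym (map-varArgs a shareAbs f1) }
  }

sharedAbs-ho : ∀ {i} (a : VarArity i) → HoStruct (sharedAbs a)
sharedAbs-ho a = record { Sc = Sc′ ; isScope = record
  { sc-root = sc-root′ ; sc-self = sc-self′ ; sc-nest = sc-nest′ ; sc-close = sc-close′
  ; sc-var = sc-var′ ; sc-back = sc-back′ a } }
  where
  G = sharedAbs a
  Sc′ : Fin 3 → Fin 3 → Set
  Sc′ f1 f1 = ⊤
  Sc′ f1 f2 = ⊤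
  Sc′ _  _  = ⊥
  sc-root′ : ∀ v → IsLam G v → ¬ Sc⁻ G Sc′ v f0
  sc-root′ f1 _ (() , _)
  sc-self′ : ∀ v → IsLam G v → Sc′ v v
  sc-self′ f1 _ = tt
  sc-self′ f0 ()
  sc-self′ f2 ()
  sc-nest′ : ∀ v₀ v₁ → IsLam G v₀ → IsLam G v₁ → Sc⁻ G Sc′ v₀ v₁ → ∀ u → Sc′ v₁ u → Sc⁻ G Sc′ v₀ u
  sc-nest′ f1 f1 _ _ (_ , ne) _ _ = ⊥-elim (ne refl)
  sc-close′ : ∀ v w k wₖ → IsLam G v → Edge G w k wₖ → Sc⁻ G Sc′ v wₖ → Sc′ v w
  sc-close′ f1 f0 _ _ _ (zero , _ , refl)     (_ , ne) = ⊥-elim (ne refl)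
  sc-close′ f1 f0 _ _ _ (suc zero , _ , refl) (_ , ne) = ⊥-elim (ne refl)
  sc-close′ f1 f1 _ _ _ (zero , _ , refl)     _        = tt
  sc-close′ f1 f2 _ _ _ e                     s        = variable-scope a e s
    where
    variable-scope : ∀ {j} (b : VarArity j) {k wₖ} → Edge (sharedAbs b) f2 k wₖ →
                     Sc⁻ (sharedAbs b) Sc′ f1 wₖ → Sc′ f1 f2
    variable-scope nullary    (() , _)
    variable-scope backLinked (zero , _ , refl) (_ , ne) = ⊥-elim (ne refl)
  sc-var′ : ∀ w → lab G w ≡ var → ∃ λ v₀ → IsLam G v₀ × Sc⁻ G Sc′ v₀ w
  sc-var′ f2 _ = f1 , refl , tt , λ ()
  sc-back′ : ∀ {j} (b : VarArity j) → j ≡ 1 → ∀ w w₀ → lab (sharedAbs b) w ≡ var →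
             Edge (sharedAbs b) w 0 w₀ →
             IsLam (sharedAbs b) w₀ × (∀ v → IsLam (sharedAbs b) v → (Sc′ v w → Sc′ v w₀) × (Sc′ v w₀ → Sc′ v w))
  sc-back′ nullary    ()
  sc-back′ backLinked _ f2 _ _ (zero , _ , refl) = refl , λ { f1 _ → (λ _ → tt) , (λ _ → tt) ; f0 () ; f2 () }

sharedAbs-ap : ∀ {i} (a : VarArity i) → APStruct (sharedAbs a)
sharedAbs-ap a = record { P = P′ ; isAP = record
  { ap-root = refl ; ap-lam = ap-lam′ ; ap-app = ap-app′ ; ap-var = ap-var′ ; ap-back = ap-back′ a } }
  where
  G = sharedAbs a
  P′ : Fin 3 → List (Fin 3)
  P′ = λ { f0 → [] ; f1 → [] ; f2 → f1 ∷ [] }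
  ap-lam′ : ∀ w w₀ → lab G w ≡ lam → Edge G w 0 w₀ → P′ w₀ ≤ₚ (P′ w ++ w ∷ [])
  ap-lam′ f1 _ _ (zero , _ , refl) = [] , refl
  ap-lam′ f0 _ () _
  ap-lam′ f2 _ () _
  ap-app′ : ∀ w k wₖ → lab G w ≡ app → Edge G w k wₖ → P′ wₖ ≤ₚ P′ w
  ap-app′ f0 _ _ _ (zero , _ , refl)     = [] , refl
  ap-app′ f0 _ _ _ (suc zero , _ , refl) = [] , refl
  ap-app′ f1 _ _ () _
  ap-app′ f2 _ _ () _
  ap-var′ : ∀ w → lab G w ≡ var → P′ w ≢ []
  ap-var′ f2 _ ()
  ap-back′ : ∀ {j} (b : VarArity j) → j ≡ 1 → ∀ w w₀ → lab (sharedAbs b) w ≡ var →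
             Edge (sharedAbs b) w 0 w₀ → lab (sharedAbs b) w₀ ≡ lam × (P′ w₀ ++ w₀ ∷ [] ≡ P′ w)
  ap-back′ nullary    ()
  ap-back′ backLinked _ f2 _ _ (zero , _ , refl) = refl , refl

not-closed-converse-FB-ho : ∀ {i} → VarArity i → ¬ ClosedUnderConverseFB {i} HoStruct IsHoHom
not-closed-converse-FB-ho a closed with closed (sharedAbs a) (sharedAbs-ho a) (sharedBody a) shareAbs (shareAbs-hom a)
... | S , hom = binder-dominates-scope (isScope S) refl (body-in-scope-of-right-abs , λ ()) root⇝body
  where
  body-in-scope-of-right-abs : Sc S f2 f3
  body-in-scope-of-right-abs with hoHom-scope-preimage S (sharedAbs-ho a) hom {f2} {f2} refl tt
  ... | f3 , s , refl = s
  root⇝body : PathAvoiding (sharedBody a) f2 f0 f3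
  root⇝body = step (λ ()) (zero , refl , refl) (step (λ ()) (zero , refl , refl) [])

not-closed-converse-FB-ap : ∀ {i} → VarArity i → ¬ ClosedUnderConverseFB {i} APStruct IsAPHom
not-closed-converse-FB-ap a closed with closed (sharedAbs a) (sharedAbs-ap a) (sharedBody a) shareAbs (shareAbs-hom a)
... | S , hom with top-binders-of-shared-body (isAP S) {f1} {f2} refl refl
                     (zero , refl , refl) (zero , refl , refl)
                     (apHom-empty-prefix S (sharedAbs-ap a) hom {f1} refl)
                     (apHom-empty-prefix S (sharedAbs-ap a) hom {f2} refl)
                     (IsAP.ap-var (isAP S) f3 refl)
...   | ()

proposition6p4 :
    ((¬ ClosedUnderFB {0} HoStruct IsHoHom) × (¬ ClosedUnderFB {0} APStruct IsAPHom) ×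
     (¬ ClosedUnderConverseFB {0} HoStruct IsHoHom) × (¬ ClosedUnderConverseFB {0} APStruct IsAPHom))
    ×
    ((¬ ClosedUnderConverseFB {1} HoStruct IsHoHom) × (¬ ClosedUnderConverseFB {1} APStruct IsAPHom))
proposition6p4 =
  ( not-closed-FB-ho
  , not-closed-FB-ap
  , not-closed-converse-FB-ho nullary
  , not-closed-converse-FB-ap nullary
  )
  , ( not-closed-converse-FB-ho backLinked
    , not-closed-converse-FB-ap backLinked
    )
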